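{- As formal power series in $z$, $$\sum_{n\ge0}Q_n(t,q)z^n=\mathfrak{J}(b^Q_h,\lambda^Q_h),\qquad \sum_{n\ge0}R_n(t,q)z^n=\mathfrak{J}(b^R_h,\lambda^R_h),$$ where $b^Q_h=tq^h([h]_q+[h+1]_q)$, $\lambda^Q_h=(1+t^2q^{2h-1})[h]_q^2$, $b^R_h=tq^h(1+q)[h+1]_q$, $\lambda^R_h=(1+t^2q^{2h})[h]_q[h+1]_q$.
   Context: Let $[n]_q=\frac{1-q^n}{1-q}$. Let $D$ and $U$ be the linear operators on polynomials in $t$ given by $D(t^n)=[n]_qt^{n-1}$ and $U(t^n)=t^{n+1}$, and define $Q_n(t,q)=(D+UDU)^n1$ and $R_n(t,q)=(D+DUU)^n1$. For sequences $(b_h)_{h\ge0}$ and $(\lambda_h)_{h\ge1}$, $\mathfrak{J}(b_h,\lambda_h)$ denotes the Jacobi continued fraction $$\cfrac{1}{1-b_0z-\cfrac{\lambda_1z^2}{1-b_1z-\cfrac{\lambda_2z^2}{\ddots}}}.$$ -}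

module Defs where

open import Data.Nat using (ℕ; zero; suc; _+_; _*_; _∸_; _≤ᵇ_; _<ᵇ_; _≡ᵇ_)
open import Data.Bool using (if_then_else_)
open import Data.List using (List; map; foldr; upTo)
open import Relation.Binary.PropositionalEquality using (_≡_)

-- A polynomial in t and q with nonnegative integer coefficients,
-- represented by its coefficient function:  P i j = [t^i q^j] P.
-- (All objects in the statement have coefficients in ℕ.)
Poly : Set
Poly = ℕ → ℕ → ℕ

0P : Poly
0P _ _ = 0

1P : Poly
1P i j = if (i ≡ᵇ 0) then (if (j ≡ᵇ 0) then 1 else 0) else 0

tP : Poly
tP i j = if (i ≡ᵇ 1) then (if (j ≡ᵇ 0) then 1 else 0) else 0

qpow : ℕ → Poly
qpow k i j = if (i ≡ᵇ 0) then (if (j ≡ᵇ k) then 1 else 0) else 0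

infixl 6 _⊕_
infixl 7 _⊗_

_⊕_ : Poly → Poly → Poly
(P ⊕ R) i j = P i j + R i j

Σℕ : ℕ → (ℕ → ℕ) → ℕ
Σℕ n f = foldr _+_ 0 (map f (upTo n))

ΣP : ℕ → (ℕ → Poly) → Poly
ΣP n f = foldr _⊕_ 0P (map f (upTo n))

_⊗_ : Poly → Poly → Poly
(P ⊗ R) i j = Σℕ (suc i) λ a → Σℕ (suc j) λ b → P a b * R (i ∸ a) (j ∸ b)

qint : ℕ → Poly
qint n i j = if (i ≡ᵇ 0) then (if (j <ᵇ n) then 1 else 0) else 0

-- Operator D : t^n ↦ [n]_q t^(n-1)   (linear over ℕ[q])
-- [t^i q^j] D P = Σ_{b=0}^{i} [t^(i+1) q^(j-b)] P  (terms with b ≤ j)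
Dop : Poly → Poly
Dop P i j = Σℕ (suc i) λ b → if (b ≤ᵇ j) then P (suc i) (j ∸ b) else 0

Uop : Poly → Poly
Uop P zero    j = 0
Uop P (suc i) j = P i j

iter : ℕ → (Poly → Poly) → Poly → Poly
iter zero    F x = x
iter (suc n) F x = F (iter n F x)

Qpoly : ℕ → Poly
Qpoly n = iter n (λ P → Dop P ⊕ Uop (Dop (Uop P))) 1P

Rpoly : ℕ → Poly
Rpoly n = iter n (λ P → Dop P ⊕ Dop (Uop (Uop P))) 1P

-- Let F_h = 1/(1 - b_h z - λ_{h+1} z^2 F_{h+1}); then F_0 = J(b_h, λ_h).
-- Equivalently F_h = 1 + b_h z F_h + λ_{h+1} z^2 F_{h+1} F_h, which determines
-- the coefficients [z^k] F_h recursively: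
--   [z^0]F_h = 1,
--   [z^(k+1)]F_h = b_h [z^k]F_h + λ_{h+1} Σ_{i+j=k-1} [z^i]F_{h+1} [z^j]F_h .
-- jcoefFuel uses a fuel argument (fuel ≥ k suffices) for structural recursion.
jcoefFuel : (ℕ → Poly) → (ℕ → Poly) → ℕ → ℕ → ℕ → Poly
jcoefFuel b λ' fuel    h zero = 1P
jcoefFuel b λ' zero    h (suc k) = 0P
jcoefFuel b λ' (suc f) h (suc zero) = b h ⊗ jcoefFuel b λ' f h zero
jcoefFuel b λ' (suc f) h (suc (suc m)) =
  b h ⊗ jcoefFuel b λ' f h (suc m)
  ⊕ λ' (suc h) ⊗ ΣP (suc m) (λ i → jcoefFuel b λ' f (suc h) i ⊗ jcoefFuel b λ' f h (m ∸ i))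

-- [z^n] J(b_h, λ_h)  (λ is indexed from 1; the value λ 0 is never used)
Jcoef : (ℕ → Poly) → (ℕ → Poly) → ℕ → Poly
Jcoef b λ' n = jcoefFuel b λ' n 0 n

bQ : ℕ → Poly
bQ h = tP ⊗ qpow h ⊗ (qint h ⊕ qint (suc h))

-- λ^Q_h = (1 + t^2 q^(2h-1)) [h]_q^2   (used only for h ≥ 1)
λQ : ℕ → Poly
λQ h = (1P ⊕ tP ⊗ tP ⊗ qpow (2 * h ∸ 1)) ⊗ qint h ⊗ qint h

bR : ℕ → Poly
bR h = tP ⊗ qpow h ⊗ (1P ⊕ qpow 1) ⊗ qint (suc h)

λR : ℕ → Poly
λR h = (1P ⊕ tP ⊗ tP ⊗ qpow (2 * h)) ⊗ qint h ⊗ qint (suc h)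

_≈P_ : Poly → Poly → Set
P ≈P R = ∀ i j → P i j ≡ R i j

-- Let U be multiplication by t and D the q-derivative on ℕ[[q]][[t]], so that D t = 1 + q t D.
-- Both D + UDU and D + DUU have the form A = t s₀ + (1 + t² r₁) D, and moving D^(k+1) across A
-- gives D^(k+1) A = w_k D^k + t s_(k+1) D^(k+1) + (1 + t² r_(k+2)) D^(k+2) for q-series s, r, w
-- obeying simple recurrences. Hence D^k A^n 1 is the total weight of the n-step Motzkin paths
-- from height k to 0 with level steps t s_h, down steps w_h and up steps 1 + t² r_h. Cutting a
-- path where it first reaches height 0 shows that A^n 1 is the n-th coefficient of the J-fraction
-- with b_h = t s_h and λ_(h+1) = w_h (1 + t² r_(h+1)), which for Q_n and R_n are the stated ones.

module Submission where

open import Algebra using (CommutativeSemiring)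
open import Algebra.Structures.Biased using (isCommutativeSemiringˡ)
open import Data.Bool using (true; false; if_then_else_)
open import Data.List using (foldr; applyUpTo)
open import Data.List.Properties using (map-upTo)
open import Data.Nat as ℕ using (ℕ; zero; suc; _∸_; _<_; _≤_; s≤s; z≤n; _<ᵇ_)
import Data.Nat.Properties as ℕₚ
open import Data.Product using (_×_; _,_)
open import Function using (_∘_)
open import Level using (0ℓ)
import Relation.Binary.PropositionalEquality as ≡
open import Relation.Binary.Structures using (IsEquivalence)
import Relation.Binary.Reasoning.Setoid as SetoidReasoning
import Algebra.Solver.Ring.NaturalCoefficients.Default as Solver
open import Defs

-- Formal power series over a commutative semiring

module PowerSeries {c ℓ} (R : CommutativeSemiring c ℓ) where

  open CommutativeSemiring R
  open SetoidReasoning setoid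
  open import Algebra.Solver.Ring.NaturalCoefficients.Default R

  ∑< : ℕ → (ℕ → Carrier) → Carrier
  ∑< zero    f = 0#
  ∑< (suc n) f = f 0 + ∑< n (f ∘ suc)

  syntax ∑< n (λ i → e) = ∑[ i < n ] e

  ∑<-foldr : ∀ n f → foldr _+_ 0# (applyUpTo f n) ≡.≡ ∑< n f
  ∑<-foldr zero    f = ≡.refl
  ∑<-foldr (suc n) f = ≡.cong (f 0 +_) (∑<-foldr n (f ∘ suc))

  ∑-cong : ∀ n {f g : ℕ → Carrier} → (∀ i → f i ≈ g i) → ∑< n f ≈ ∑< n g
  ∑-cong zero    f≈g = refl
  ∑-cong (suc n) f≈g = +-cong (f≈g 0) (∑-cong n (f≈g ∘ suc))

  ∑-cong< : ∀ n {f g : ℕ → Carrier} → (∀ i → i < n → f i ≈ g i) → ∑< n f ≈ ∑< n g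
  ∑-cong< zero    f≈g = refl
  ∑-cong< (suc n) f≈g = +-cong (f≈g 0 (s≤s z≤n)) (∑-cong< n (λ i i<n → f≈g (suc i) (s≤s i<n)))

  ∑-zero : ∀ n → ∑[ _ < n ] 0# ≈ 0#
  ∑-zero zero    = refl
  ∑-zero (suc n) = trans (+-cong refl (∑-zero n)) (+-identityˡ 0#)

  ∑-+ : ∀ n (f g : ℕ → Carrier) → ∑[ i < n ] (f i + g i) ≈ ∑< n f + ∑< n g
  ∑-+ zero    f g = sym (+-identityˡ 0#)
  ∑-+ (suc n) f g = begin
    (f 0 + g 0) + ∑[ i < n ] (f (suc i) + g (suc i))  ≈⟨ +-cong refl (∑-+ n (f ∘ suc) (g ∘ suc)) ⟩
    (f 0 + g 0) + (∑< n (f ∘ suc) + ∑< n (g ∘ suc))   ≈⟨ interchange _ _ _ _ ⟩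
    (f 0 + ∑< n (f ∘ suc)) + (g 0 + ∑< n (g ∘ suc))   ∎
    where open import Algebra.Properties.CommutativeSemigroup +-commutativeSemigroup using (interchange)

  *-distribˡ-∑ : ∀ n x (f : ℕ → Carrier) → x * ∑< n f ≈ ∑[ i < n ] (x * f i)
  *-distribˡ-∑ zero    x f = zeroʳ x
  *-distribˡ-∑ (suc n) x f = trans (distribˡ x _ _) (+-cong refl (*-distribˡ-∑ n x (f ∘ suc)))

  ∑-distribʳ-+ : ∀ n (f g a : ℕ → Carrier) →
                 ∑[ i < n ] ((f i + g i) * a i) ≈ ∑[ i < n ] (f i * a i) + ∑[ i < n ] (g i * a i)
  ∑-distribʳ-+ n f g a = trans (∑-cong n {λ i → (f i + g i) * a i} (λ i → distribʳ (a i) (f i) (g i)))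
                               (∑-+ n (λ i → f i * a i) (λ i → g i * a i))

  ∑-*-assoc : ∀ n x (g a : ℕ → Carrier) → ∑[ i < n ] ((x * g i) * a i) ≈ x * ∑[ i < n ] (g i * a i)
  ∑-*-assoc n x g a = trans (∑-cong n {λ i → (x * g i) * a i} (λ i → *-assoc x (g i) (a i)))
                            (sym (*-distribˡ-∑ n x (λ i → g i * a i)))

  ∑-snoc : ∀ n f → ∑< (suc n) f ≈ ∑< n f + f n
  ∑-snoc zero    f = +-comm (f 0) 0#
  ∑-snoc (suc n) f = trans (+-cong refl (∑-snoc n (f ∘ suc))) (sym (+-assoc _ _ _))

  ∑-reverse : ∀ n f → ∑< (suc n) f ≈ ∑[ i < suc n ] f (n ∸ i)
  ∑-reverse zero    f = refl
  ∑-reverse (suc n) f = begin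
    ∑< (suc (suc n)) f                    ≈⟨ ∑-snoc (suc n) f ⟩
    ∑< (suc n) f + f (suc n)              ≈⟨ +-comm _ _ ⟩
    f (suc n) + ∑< (suc n) f              ≈⟨ +-cong refl (∑-reverse n f) ⟩
    f (suc n) + ∑[ i < suc n ] f (n ∸ i)  ∎

  Series : Set c
  Series = ℕ → Carrier

  -- A record, so that f and g can be inferred from a proof of f ≋ g.
  infix 4 _≋_
  record _≋_ (f g : Series) : Set ℓ where
    constructor coeffwise
    field coeff : ∀ n → f n ≈ g n
  open _≋_ public

  C : Carrier → Series
  C a zero    = a
  C a (suc _) = 0#

  0ˢ 1ˢ : Series
  0ˢ _ = 0#
  1ˢ   = C 1#

  infixl 6 _+ˢ_
  infixl 7 _*ˢ_ _·_

  _+ˢ_ : Series → Series → Series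
  (f +ˢ g) n = f n + g n

  _*ˢ_ : Series → Series → Series
  (f *ˢ g) n = ∑[ i < suc n ] (f i * g (n ∸ i))

  _·_ : Carrier → Series → Series
  (a · f) n = a * f n

  *ˢ-cong : ∀ {f f′ g g′} → f ≋ f′ → g ≋ g′ → f *ˢ g ≋ f′ *ˢ g′
  *ˢ-cong f≋f′ g≋g′ = coeffwise λ n → ∑-cong (suc n) λ i → *-cong (coeff f≋f′ i) (coeff g≋g′ (n ∸ i))

  *ˢ-comm : ∀ f g → f *ˢ g ≋ g *ˢ f
  *ˢ-comm f g = coeffwise λ n → begin
    ∑[ i < suc n ] (f i * g (n ∸ i))              ≈⟨ ∑-reverse n (λ i → f i * g (n ∸ i)) ⟩
    ∑[ i < suc n ] (f (n ∸ i) * g (n ∸ (n ∸ i)))  ≈⟨ ∑-cong< (suc n) {g = λ i → g i * f (n ∸ i)} (λ i i<1+n →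
                                                       trans (*-comm _ _) (*-cong (g-cancel i<1+n) refl)) ⟩
    ∑[ i < suc n ] (g i * f (n ∸ i))              ∎
    where
    g-cancel : ∀ {n i} → i < suc n → g (n ∸ (n ∸ i)) ≈ g i
    g-cancel i<1+n = reflexive (≡.cong g (ℕₚ.m∸[m∸n]≡n (ℕₚ.≤-pred i<1+n)))

  *ˢ-zeroˡ : ∀ g → 0ˢ *ˢ g ≋ 0ˢ
  *ˢ-zeroˡ g = coeffwise λ n →
    trans (∑-cong (suc n) {λ i → 0# * g (n ∸ i)} (λ i → zeroˡ (g (n ∸ i)))) (∑-zero (suc n))

  *ˢ-distribʳ : ∀ h f g → (f +ˢ g) *ˢ h ≋ f *ˢ h +ˢ g *ˢ h
  *ˢ-distribʳ h f g = coeffwise λ n →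
    ∑-distribʳ-+ (suc n) f g (λ i → h (n ∸ i))

  ·-*ˢ : ∀ a f g → (a · f) *ˢ g ≋ a · (f *ˢ g)
  ·-*ˢ a f g = coeffwise λ n →
    ∑-*-assoc (suc n) a f (λ i → g (n ∸ i))

  C-*ˢ : ∀ a g → C a *ˢ g ≋ a · g
  C-*ˢ a g = coeffwise λ
    { zero    → +-identityʳ _
    ; (suc n) → trans (+-cong refl (coeff (*ˢ-zeroˡ g) n)) (+-identityʳ _) }

  *ˢ-identityˡ : ∀ g → 1ˢ *ˢ g ≋ g
  *ˢ-identityˡ g = coeffwise λ n → trans (coeff (C-*ˢ 1# g) n) (*-identityˡ (g n))

  *ˢ-assoc : ∀ f g h → (f *ˢ g) *ˢ h ≋ f *ˢ (g *ˢ h)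
  *ˢ-assoc f g h = coeffwise (assoc f g h)
    where
    assoc : ∀ f g h n → ((f *ˢ g) *ˢ h) n ≈ (f *ˢ (g *ˢ h)) n
    assoc f g h zero =
      solve 3 (λ a b x → (a :* b :+ con 0) :* x :+ con 0 := a :* (b :* x :+ con 0) :+ con 0) refl (f 0) (g 0) (h 0)
    assoc f g h (suc n) = begin
      (f *ˢ g) 0 * h (suc n) + (((f *ˢ g) ∘ suc) *ˢ h) n
        ≈⟨ +-cong refl (coeff (*ˢ-distribʳ h (f 0 · (g ∘ suc)) ((f ∘ suc) *ˢ g)) n) ⟩
      (f *ˢ g) 0 * h (suc n) + (((f 0 · (g ∘ suc)) *ˢ h) n + (((f ∘ suc) *ˢ g) *ˢ h) n)
        ≈⟨ +-cong refl (+-cong (coeff (·-*ˢ (f 0) (g ∘ suc) h) n) (assoc (f ∘ suc) g h n)) ⟩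
      (f 0 * g 0 + 0#) * h (suc n) + (f 0 * ((g ∘ suc) *ˢ h) n + ((f ∘ suc) *ˢ (g *ˢ h)) n)
        ≈⟨ solve 5 (λ a b x y z → (a :* b :+ con 0) :* x :+ (a :* y :+ z) := a :* (b :* x :+ y) :+ z) refl
                   (f 0) (g 0) (h (suc n)) (((g ∘ suc) *ˢ h) n) (((f ∘ suc) *ˢ (g *ˢ h)) n) ⟩
      f 0 * (g *ˢ h) (suc n) + ((f ∘ suc) *ˢ (g *ˢ h)) n ∎

  seriesSemiring : CommutativeSemiring c ℓ
  seriesSemiring = record
    { Carrier = Series
    ; _≈_ = _≋_
    ; _+_ = _+ˢ_
    ; _*_ = _*ˢ_
    ; 0# = 0ˢ
    ; 1# = 1ˢ
    ; isCommutativeSemiring = isCommutativeSemiringˡ record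
      { +-isCommutativeMonoid = record
        { isMonoid = record
          { isSemigroup = record
            { isMagma = record
              { isEquivalence = ≋-isEquivalence
              ; ∙-cong = λ f≋f′ g≋g′ → coeffwise λ n → +-cong (coeff f≋f′ n) (coeff g≋g′ n) }
            ; assoc = λ f g h → coeffwise λ n → +-assoc (f n) (g n) (h n) }
          ; identity = (λ f → coeffwise λ n → +-identityˡ (f n)) , (λ f → coeffwise λ n → +-identityʳ (f n)) }
        ; comm = λ f g → coeffwise λ n → +-comm (f n) (g n) }
      ; *-isCommutativeMonoid = record
        { isMonoid = record
          { isSemigroup = record
            { isMagma = record { isEquivalence = ≋-isEquivalence ; ∙-cong = *ˢ-cong }
            ; assoc = *ˢ-assoc }
          ; identity = *ˢ-identityˡ , λ f → ≋-trans (*ˢ-comm f 1ˢ) (*ˢ-identityˡ f) }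
        ; comm = *ˢ-comm }
      ; distribʳ = *ˢ-distribʳ
      ; zeroˡ = *ˢ-zeroˡ
      }
    }
    where
    ≋-trans : ∀ {f g h} → f ≋ g → g ≋ h → f ≋ h
    ≋-trans f≋g g≋h = coeffwise λ n → trans (coeff f≋g n) (coeff g≋h n)
    ≋-isEquivalence : IsEquivalence _≋_
    ≋-isEquivalence = record
      { refl = coeffwise λ _ → refl
      ; sym = λ f≋g → coeffwise λ n → sym (coeff f≋g n)
      ; trans = ≋-trans }

  X : Series
  X zero    = 0#
  X (suc n) = 1ˢ n

  shift : Series → Series
  shift f zero    = 0#
  shift f (suc n) = f n

  X-*ˢ : ∀ f → X *ˢ f ≋ shift f
  X-*ˢ f = coeffwise λ
    { zero    → trans (+-identityʳ _) (zeroˡ (f 0))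
    ; (suc n) → trans (+-cong (zeroˡ _) (coeff (*ˢ-identityˡ f) n)) (+-identityˡ (f n)) }

  C-+ : ∀ a b → C (a + b) ≋ C a +ˢ C b
  C-+ a b = coeffwise λ { zero → refl ; (suc n) → sym (+-identityˡ 0#) }

  C-* : ∀ a b → C (a * b) ≋ C a *ˢ C b
  C-* a b = coeffwise λ n → sym (trans (coeff (C-*ˢ a (C b)) n) (a*Cb≈Cab n))
    where
    a*Cb≈Cab : ∀ n → a * C b n ≈ C (a * b) n
    a*Cb≈Cab zero    = refl
    a*Cb≈Cab (suc n) = zeroʳ a

  C-cong : ∀ {a b} → a ≈ b → C a ≋ C b
  C-cong a≈b = coeffwise λ { zero → a≈b ; (suc n) → refl }

-- Weighted Motzkin paths

module MotzkinPaths {c ℓ} (S : CommutativeSemiring c ℓ) where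

  open CommutativeSemiring S
  open PowerSeries S using (∑<; ∑-distribʳ-+; ∑-*-assoc)
  open SetoidReasoning setoid

  -- A level step at height h weighs level h, a down step from h + 1 to h
  -- weighs down h, an up step from h to h + 1 weighs up (h + 1).
  record Weights : Set c where
    field level down up : ℕ → Carrier
  open Weights

  raise : Weights → Weights
  raise ω = record { level = level ω ∘ suc ; down = down ω ∘ suc ; up = up ω ∘ suc }

  step : Weights → (ℕ → Carrier) → ℕ → Carrier
  step ω v zero    = level ω 0 * v 0 + up ω 1 * v 1
  step ω v (suc k) =
    down ω k * v k + (level ω (suc k) * v (suc k) + up ω (suc (suc k)) * v (suc (suc k)))

  -- paths ω n k is the total weight of the n-step paths from height k to height 0.
  paths : Weights → ℕ → ℕ → Carrier
  paths ω zero    zero    = 1#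
  paths ω zero    (suc k) = 0#
  paths ω (suc n)         = step ω (paths ω n)

  step-cong : ∀ ω {u v} → (∀ k → u k ≈ v k) → ∀ k → step ω u k ≈ step ω v k
  step-cong ω u≈v zero    = +-cong (*-cong refl (u≈v 0)) (*-cong refl (u≈v 1))
  step-cong ω u≈v (suc k) =
    +-cong (*-cong refl (u≈v k)) (+-cong (*-cong refl (u≈v (suc k))) (*-cong refl (u≈v (suc (suc k)))))

  step-zero : ∀ ω k → step ω (λ _ → 0#) k ≈ 0#
  step-zero ω zero    = trans (+-cong (zeroʳ _) (zeroʳ _)) (+-identityˡ 0#)
  step-zero ω (suc k) = trans (+-cong (zeroʳ _) (trans (+-cong (zeroʳ _) (zeroʳ _)) (+-identityˡ 0#))) (+-identityˡ 0#)

  -- Above height 0 the walk sees the raised weights, except for the step down to 0.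
  step-suc : ∀ ω v k → step ω v (suc k) ≈ paths (raise ω) 0 k * (down ω 0 * v 0) + step (raise ω) (v ∘ suc) k
  step-suc ω v zero    = +-cong (sym (*-identityˡ _)) refl
  step-suc ω v (suc k) = sym (trans (+-cong (zeroˡ _) refl) (+-identityˡ _))

  step-∑ : ∀ ω n (f : ℕ → ℕ → Carrier) (a : ℕ → Carrier) k →
           step ω (λ j → ∑[ i < n ] (f i j * a i)) k ≈ ∑[ i < n ] (step ω (f i) k * a i)
  step-∑ ω n f a zero = sym (begin
    ∑[ i < n ] ((x * f i 0 + y * f i 1) * a i)
      ≈⟨ ∑-distribʳ-+ n _ _ a ⟩
    _ ≈⟨ +-cong (∑-*-assoc n x (λ i → f i 0) a) (∑-*-assoc n y (λ i → f i 1) a) ⟩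
    x * ∑[ i < n ] (f i 0 * a i) + y * ∑[ i < n ] (f i 1 * a i) ∎)
    where x = level ω 0 ; y = up ω 1
  step-∑ ω n f a (suc k) = sym (begin
    ∑[ i < n ] ((x * f i k + (y * f i (suc k) + z * f i (suc (suc k)))) * a i)
      ≈⟨ ∑-distribʳ-+ n _ _ a ⟩
    _ ≈⟨ +-cong (∑-*-assoc n x (λ i → f i k) a) (∑-distribʳ-+ n _ _ a) ⟩
    _ ≈⟨ +-cong refl (+-cong (∑-*-assoc n y (λ i → f i (suc k)) a) (∑-*-assoc n z (λ i → f i (suc (suc k))) a)) ⟩
    x * ∑[ i < n ] (f i k * a i)
      + (y * ∑[ i < n ] (f i (suc k) * a i) + z * ∑[ i < n ] (f i (suc (suc k)) * a i)) ∎)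
    where x = down ω k ; y = level ω (suc k) ; z = up ω (suc (suc k))

  paths-first-passage : ∀ ω n k →
    paths ω (suc n) (suc k) ≈ ∑[ i < suc n ] (paths (raise ω) i k * (down ω 0 * paths ω (n ∸ i) 0))
  paths-first-passage ω zero k    = trans (step-suc ω (paths ω 0) k) (+-cong refl (step-zero (raise ω) k))
  paths-first-passage ω (suc n) k = begin
    step ω (paths ω (suc n)) (suc k)
      ≈⟨ step-suc ω (paths ω (suc n)) k ⟩
    paths ω⁺ 0 k * (down ω 0 * paths ω (suc n) 0) + step ω⁺ (paths ω (suc n) ∘ suc) k
      ≈⟨ +-cong refl (step-cong ω⁺ (paths-first-passage ω n) k) ⟩
    paths ω⁺ 0 k * (down ω 0 * paths ω (suc n) 0) + step ω⁺ (λ j → ∑[ i < suc n ] (paths ω⁺ i j * a i)) k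
      ≈⟨ +-cong refl (step-∑ ω⁺ (suc n) (paths ω⁺) a k) ⟩
    paths ω⁺ 0 k * (down ω 0 * paths ω (suc n) 0) + ∑[ i < suc n ] (paths ω⁺ (suc i) k * a i) ∎
    where
    ω⁺ = raise ω
    a : ℕ → Carrier
    a i = down ω 0 * paths ω (n ∸ i) 0

-- The semiring ℕ[[q]][[t]] and the operators t and D

module ℕ⟦q⟧ˢ = PowerSeries ℕₚ.+-*-commutativeSemiring

ℕ⟦q⟧ : CommutativeSemiring 0ℓ 0ℓ
ℕ⟦q⟧ = ℕ⟦q⟧ˢ.seriesSemiring

module ℕ⟦q⟧⟦t⟧ˢ = PowerSeries ℕ⟦q⟧

-- Its carrier ℕ → ℕ → ℕ is Poly, with _+_ and 0# definitionally _⊕_ and 0P.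
ℕ⟦q⟧⟦t⟧ : CommutativeSemiring 0ℓ 0ℓ
ℕ⟦q⟧⟦t⟧ = ℕ⟦q⟧⟦t⟧ˢ.seriesSemiring

module Q = CommutativeSemiring ℕ⟦q⟧
open Q using () renaming (_+_ to _+q_; _*_ to _*q_; _≈_ to _≈q_; 0# to 0q; 1# to 1q)
open CommutativeSemiring ℕ⟦q⟧⟦t⟧
open ℕ⟦q⟧⟦t⟧ˢ using (C; C-+; C-*; C-cong; C-*ˢ; X-*ˢ; coeffwise; coeff)

module QSolver = Solver ℕ⟦q⟧
module TSolver = Solver ℕ⟦q⟧⟦t⟧

q^_ : ℕ → Q.Carrier
(q^ k) j = if j ℕ.≡ᵇ k then 1 else 0

[_]q : ℕ → Q.Carrier
[ n ]q j = if j <ᵇ n then 1 else 0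

q : Q.Carrier
q = q^ 1

q*-shift : ∀ f → q *q f ≈q ℕ⟦q⟧ˢ.shift f
q*-shift f = Q.trans (Q.*-cong q≈X (Q.refl {f})) (ℕ⟦q⟧ˢ.X-*ˢ f)
  where
  q≈X : q ≈q ℕ⟦q⟧ˢ.X
  q≈X = ℕ⟦q⟧ˢ.coeffwise λ { zero → ≡.refl ; (suc zero) → ≡.refl ; (suc (suc j)) → ≡.refl }

q^-zero : q^ 0 ≈q 1q
q^-zero = ℕ⟦q⟧ˢ.coeffwise λ { zero → ≡.refl ; (suc j) → ≡.refl }

q^-suc : ∀ k → q^ suc k ≈q q *q q^ k
q^-suc k = Q.sym (Q.trans (q*-shift (q^ k)) (ℕ⟦q⟧ˢ.coeffwise λ { zero → ≡.refl ; (suc j) → ≡.refl }))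

q^-+ : ∀ m n → q^ (m ℕ.+ n) ≈q q^ m *q q^ n
q^-+ zero    n = Q.sym (Q.trans (Q.*-cong q^-zero (Q.refl {q^ n})) (Q.*-identityˡ (q^ n)))
q^-+ (suc m) n = begin
  q^ suc (m ℕ.+ n)      ≈⟨ q^-suc (m ℕ.+ n) ⟩
  q *q q^ (m ℕ.+ n)     ≈⟨ Q.*-cong (Q.refl {q}) (q^-+ m n) ⟩
  q *q (q^ m *q q^ n)   ≈⟨ Q.sym (Q.*-assoc q (q^ m) (q^ n)) ⟩
  (q *q q^ m) *q q^ n   ≈⟨ Q.*-cong (Q.sym (q^-suc m)) (Q.refl {q^ n}) ⟩
  q^ suc m *q q^ n      ∎
  where open SetoidReasoning Q.setoid

[0]q : [ 0 ]q ≈q 0q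
[0]q = ℕ⟦q⟧ˢ.coeffwise λ _ → ≡.refl

[1]q : [ 1 ]q ≈q 1q
[1]q = ℕ⟦q⟧ˢ.coeffwise λ { zero → ≡.refl ; (suc j) → ≡.refl }

[suc]q : ∀ n → [ suc n ]q ≈q [ n ]q +q q^ n
[suc]q n = ℕ⟦q⟧ˢ.coeffwise (pointwise n)
  where
  pointwise : ∀ n j → [ suc n ]q j ≡.≡ [ n ]q j ℕ.+ (q^ n) j
  pointwise zero    zero    = ≡.refl
  pointwise zero    (suc j) = ≡.refl
  pointwise (suc n) zero    = ≡.refl
  pointwise (suc n) (suc j) = pointwise n j

[suc]q-horner : ∀ n → [ suc n ]q ≈q 1q +q q *q [ n ]q
[suc]q-horner n =
  Q.sym (Q.trans (Q.+-cong (Q.refl {1q}) (q*-shift [ n ]q)) (ℕ⟦q⟧ˢ.coeffwise λ { zero → ≡.refl ; (suc j) → ≡.refl }))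

q^-double : ∀ h → q^ (2 ℕ.* h) ≈q q^ h *q q^ h
q^-double h = Q.trans (Q.reflexive (≡.cong (λ e → q^ (h ℕ.+ e)) (ℕₚ.+-identityʳ h))) (q^-+ h h)

q^-2+ : ∀ e → q^ (2 ℕ.+ e) ≈q q *q (q *q q^ e)
q^-2+ e = Q.trans (q^-suc (suc e)) (Q.*-cong (Q.refl {q}) (q^-suc e))

t : Carrier
t = tP

t*-shift : ∀ f → t * f ≈ ℕ⟦q⟧⟦t⟧ˢ.shift f
t*-shift f = trans (*-cong t≈X (refl {f})) (X-*ˢ f)
  where
  t≈X : t ≈ ℕ⟦q⟧⟦t⟧ˢ.X
  t≈X = coeffwise λ
    { zero          → Q.refl
    ; (suc zero)    → ℕ⟦q⟧ˢ.coeffwise λ { zero → ≡.refl ; (suc j) → ≡.refl }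
    ; (suc (suc i)) → Q.refl }

Uop≈t* : ∀ f → Uop f ≈ t * f
Uop≈t* f = sym (trans (t*-shift f) (coeffwise λ { zero → Q.refl ; (suc i) → Q.refl }))

D : Carrier → Carrier
D f i = [ suc i ]q *q f (suc i)

D-cong : ∀ {f g} → f ≈ g → D f ≈ D g
D-cong f≈g = coeffwise λ i → Q.*-cong (Q.refl {[ suc i ]q}) (coeff f≈g (suc i))

D-+ : ∀ f g → D (f + g) ≈ D f + D g
D-+ f g = coeffwise λ i → Q.distribˡ [ suc i ]q (f (suc i)) (g (suc i))

D-C* : ∀ a f → D (C a * f) ≈ C a * D f
D-C* a f = coeffwise λ i → begin
  [ suc i ]q *q (C a * f) (suc i)  ≈⟨ Q.*-cong (Q.refl {[ suc i ]q}) (coeff (C-*ˢ a f) (suc i)) ⟩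
  [ suc i ]q *q (a *q f (suc i))   ≈⟨ x∙yz≈y∙xz [ suc i ]q a (f (suc i)) ⟩
  a *q D f i                       ≈⟨ Q.sym (coeff (C-*ˢ a (D f)) i) ⟩
  (C a * D f) i                    ∎
  where open SetoidReasoning Q.setoid
        open import Algebra.Properties.CommutativeSemigroup Q.*-commutativeSemigroup using (x∙yz≈y∙xz)

-- The q-Weyl relation D t = 1 + q t D, from [ i + 2 ]q = 1 + q [ i + 1 ]q.
D-t* : ∀ f → D (t * f) ≈ f + t * (C q * D f)
D-t* f = coeffwise λ i → begin
  [ suc i ]q *q (t * f) (suc i)           ≈⟨ Q.*-cong (Q.refl {[ suc i ]q}) (coeff (t*-shift f) (suc i)) ⟩
  [ suc i ]q *q f i                       ≈⟨ horner-step i ⟩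
  f i +q ℕ⟦q⟧⟦t⟧ˢ.shift (C q * D f) i     ≈⟨ Q.+-cong (Q.refl {f i}) (Q.sym (coeff (t*-shift (C q * D f)) i)) ⟩
  (f + t * (C q * D f)) i                 ∎
  where
  open SetoidReasoning Q.setoid
  horner-step : ∀ i → [ suc i ]q *q f i ≈q f i +q ℕ⟦q⟧⟦t⟧ˢ.shift (C q * D f) i
  horner-step zero    = Q.trans (Q.*-cong [1]q (Q.refl {f 0})) (Q.trans (Q.*-identityˡ (f 0)) (Q.sym (Q.+-identityʳ (f 0))))
  horner-step (suc k) = begin
    [ suc (suc k) ]q *q f (suc k)             ≈⟨ Q.*-cong ([suc]q-horner (suc k)) (Q.refl {f (suc k)}) ⟩
    (1q +q q *q [ suc k ]q) *q f (suc k)      ≈⟨ Q.distribʳ (f (suc k)) 1q (q *q [ suc k ]q) ⟩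
    1q *q f (suc k) +q (q *q [ suc k ]q) *q f (suc k)
      ≈⟨ Q.+-cong (Q.*-identityˡ (f (suc k))) (Q.*-assoc q [ suc k ]q (f (suc k))) ⟩
    f (suc k) +q q *q D f k                   ≈⟨ Q.+-cong (Q.refl {f (suc k)}) (Q.sym (coeff (C-*ˢ q (D f)) k)) ⟩
    f (suc k) +q (C q * D f) k                ∎

module ∑ᵗ = PowerSeries ℕ⟦q⟧⟦t⟧

Σℕ≡∑ : ∀ n f → Σℕ n f ≡.≡ ℕ⟦q⟧ˢ.∑< n f
Σℕ≡∑ n f = ≡.trans (≡.cong (foldr ℕ._+_ 0) (map-upTo f n)) (ℕ⟦q⟧ˢ.∑<-foldr n f)

ΣP≈∑ : ∀ n F → ΣP n F ≈ ∑ᵗ.∑< n F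
ΣP≈∑ n F = reflexive (≡.trans (≡.cong (foldr _+_ 0#) (map-upTo F n)) (∑ᵗ.∑<-foldr n F))

∑-coeff : ∀ n (F : ℕ → Q.Carrier) j → ℕ⟦q⟧⟦t⟧ˢ.∑< n F j ≡.≡ ℕ⟦q⟧ˢ.∑< n (λ a → F a j)
∑-coeff zero    F j = ≡.refl
∑-coeff (suc n) F j = ≡.cong (F 0 j ℕ.+_) (∑-coeff n (F ∘ suc) j)

⊗≈* : ∀ f g → f ⊗ g ≈ f * g
⊗≈* f g = coeffwise λ i → ℕ⟦q⟧ˢ.coeffwise λ j → begin
  Σℕ (suc i) (λ a → Σℕ (suc j) λ b → f a b ℕ.* g (i ∸ a) (j ∸ b))
    ≡⟨ Σℕ≡∑ (suc i) (λ a → Σℕ (suc j) λ b → f a b ℕ.* g (i ∸ a) (j ∸ b)) ⟩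
  ℕ⟦q⟧ˢ.∑< (suc i) (λ a → Σℕ (suc j) λ b → f a b ℕ.* g (i ∸ a) (j ∸ b))
    ≡⟨ ℕ⟦q⟧ˢ.∑-cong (suc i) (λ a → Σℕ≡∑ (suc j) (λ b → f a b ℕ.* g (i ∸ a) (j ∸ b))) ⟩
  ℕ⟦q⟧ˢ.∑< (suc i) (λ a → (f a *q g (i ∸ a)) j)
    ≡⟨ ∑-coeff (suc i) (λ a → f a *q g (i ∸ a)) j ⟨
  (f * g) i j ∎
  where open ≡.≡-Reasoning

1P≈1 : 1P ≈ 1#
1P≈1 = coeffwise λ { zero → ℕ⟦q⟧ˢ.coeffwise λ { zero → ≡.refl ; (suc j) → ≡.refl } ; (suc i) → Q.refl }

qpow≈C : ∀ k → qpow k ≈ C (q^ k)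
qpow≈C k = coeffwise λ { zero → Q.refl ; (suc i) → Q.refl }

qint≈C : ∀ n → qint n ≈ C [ n ]q
qint≈C n = coeffwise λ { zero → Q.refl ; (suc i) → Q.refl }

-- Both sides are the sum of f (i + 1) (j ∸ b) over b ≤ min i j.
Dop≈D : ∀ f → Dop f ≈ D f
Dop≈D f = coeffwise λ i → ℕ⟦q⟧ˢ.coeffwise λ j → begin
  Σℕ (suc i) (λ b → if b ℕ.≤ᵇ j then f (suc i) (j ∸ b) else 0)
    ≡⟨ Σℕ≡∑ (suc i) (λ b → if b ℕ.≤ᵇ j then f (suc i) (j ∸ b) else 0) ⟩
  ℕ⟦q⟧ˢ.∑< (suc i) (λ b → if b <ᵇ suc j then f (suc i) (j ∸ b) else 0)
    ≡⟨ ∑-truncation-swap (suc i) (suc j) (λ b → f (suc i) (j ∸ b)) ⟩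
  ℕ⟦q⟧ˢ.∑< (suc j) (λ b → if b <ᵇ suc i then f (suc i) (j ∸ b) else 0)
    ≡⟨ ℕ⟦q⟧ˢ.∑-cong (suc j) {λ b → [ suc i ]q b ℕ.* f (suc i) (j ∸ b)}
                     (λ b → if-1*x (b <ᵇ suc i) (f (suc i) (j ∸ b))) ⟨
  D f i j ∎
  where
  open ≡.≡-Reasoning
  if-1*x : ∀ c x → (if c then 1 else 0) ℕ.* x ≡.≡ (if c then x else 0)
  if-1*x true  x = ℕₚ.*-identityˡ x
  if-1*x false x = ≡.refl
  ∑-truncation-swap : ∀ m n (F : ℕ → ℕ) →
    ℕ⟦q⟧ˢ.∑< m (λ b → if b <ᵇ n then F b else 0) ≡.≡ ℕ⟦q⟧ˢ.∑< n (λ b → if b <ᵇ m then F b else 0)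
  ∑-truncation-swap zero    n       F = ≡.sym (ℕ⟦q⟧ˢ.∑-zero n)
  ∑-truncation-swap (suc m) zero    F = ℕ⟦q⟧ˢ.∑-zero (suc m)
  ∑-truncation-swap (suc m) (suc n) F = ≡.cong (F 0 ℕ.+_) (∑-truncation-swap m n (F ∘ suc))

⊗-cong : ∀ {f f′ g g′} → f ≈ f′ → g ≈ g′ → f ⊗ g ≈ f′ * g′
⊗-cong {f} {_} {g} f≈f′ g≈g′ = trans (⊗≈* f g) (*-cong f≈f′ g≈g′)

≈⇒≈P : ∀ {f g} → f ≈ g → f ≈P g
≈⇒≈P f≈g i j = ℕ⟦q⟧ˢ.coeff (coeff f≈g i) j

Dop-cong : ∀ {f g} → f ≈ g → Dop f ≈ D g
Dop-cong {f} f≈g = trans (Dop≈D f) (D-cong f≈g)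

Uop-cong : ∀ {f g} → f ≈ g → Uop f ≈ t * g
Uop-cong {f} f≈g = trans (Uop≈t* f) (*-cong (refl {t}) f≈g)

-- The Jacobi continued fraction as a path sum

open MotzkinPaths ℕ⟦q⟧⟦t⟧ using (Weights; raise; paths; paths-first-passage)
open Weights
open ∑ᵗ using (∑<)

jcoefFuel-suc-suc : ∀ b λ′ fuel h m → let J = jcoefFuel b λ′ fuel in
  jcoefFuel b λ′ (suc fuel) h (suc (suc m))
    ≈ b h * J h (suc m) + λ′ (suc h) * ∑[ i < suc m ] (J (suc h) i * J h (m ∸ i))
jcoefFuel-suc-suc b λ′ fuel h m =
  +-cong (⊗≈* (b h) (J h (suc m)))
         (trans (⊗≈* (λ′ (suc h)) (ΣP (suc m) F)) (*-cong (refl {λ′ (suc h)})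
                (trans (ΣP≈∑ (suc m) F) (∑ᵗ.∑-cong (suc m) {F} (λ i → ⊗≈* (J (suc h) i) (J h (m ∸ i)))))))
  where
  J = jcoefFuel b λ′ fuel
  F : ℕ → Carrier
  F i = J (suc h) i ⊗ J h (m ∸ i)

jcoefFuel≈paths : ∀ (b λ′ : ℕ → Carrier) ω fuel h →
                  (∀ x → b (x ℕ.+ h) ≈ level ω x) →
                  (∀ x → λ′ (suc (x ℕ.+ h)) ≈ down ω x * up ω (suc x)) →
                  ∀ k → k ≤ fuel → jcoefFuel b λ′ fuel h k ≈ paths ω k 0
jcoefFuel≈paths b λ′ ω fuel       h b≈ λ≈ zero          _ = 1P≈1
jcoefFuel≈paths b λ′ ω (suc fuel) h b≈ λ≈ (suc zero)    _ = begin
  b h ⊗ 1P                        ≈⟨ trans (⊗≈* (b h) 1P) (*-cong (b≈ 0) 1P≈1) ⟩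
  level ω 0 * 1#                  ≈⟨ sym (+-identityʳ _) ⟩
  level ω 0 * 1# + 0#             ≈⟨ +-cong (refl {level ω 0 * 1#}) (sym (zeroʳ (up ω 1))) ⟩
  level ω 0 * 1# + up ω 1 * 0#    ∎
  where open SetoidReasoning setoid
jcoefFuel≈paths b λ′ ω (suc fuel) h b≈ λ≈ (suc (suc m)) (s≤s 1+m≤fuel) = begin
  jcoefFuel b λ′ (suc fuel) h (suc (suc m))
    ≈⟨ jcoefFuel-suc-suc b λ′ fuel h m ⟩
  b h * J (suc m) + λ′ (suc h) * ∑[ i < suc m ] (J⁺ i * J (m ∸ i))
    ≈⟨ +-cong (*-cong (b≈ 0) (IH (suc m) 1+m≤fuel))
              (*-cong (λ≈ 0) (∑ᵗ.∑-cong< (suc m) {λ i → J⁺ i * J (m ∸ i)} λ i i<1+m →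
                 *-cong (IH⁺ i (ℕₚ.≤-trans (ℕₚ.≤-pred i<1+m) m≤fuel))
                        (IH (m ∸ i) (ℕₚ.≤-trans (ℕₚ.m∸n≤m m i) m≤fuel)))) ⟩
  level ω 0 * paths ω (suc m) 0 + (down ω 0 * up ω 1) * ∑[ i < suc m ] (paths ω⁺ i 0 * paths ω (m ∸ i) 0)
    ≈⟨ +-cong (refl {level ω 0 * paths ω (suc m) 0}) regroup ⟩
  level ω 0 * paths ω (suc m) 0 + up ω 1 * ∑[ i < suc m ] (paths ω⁺ i 0 * (down ω 0 * paths ω (m ∸ i) 0))
    ≈⟨ +-cong (refl {level ω 0 * paths ω (suc m) 0}) (*-cong (refl {up ω 1}) (sym (paths-first-passage ω m 0))) ⟩
  paths ω (suc (suc m)) 0 ∎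
  where
  open SetoidReasoning setoid
  ω⁺ = raise ω
  J  = jcoefFuel b λ′ fuel h
  J⁺ = jcoefFuel b λ′ fuel (suc h)
  m≤fuel : m ≤ fuel
  m≤fuel = ℕₚ.≤-trans (ℕₚ.n≤1+n m) 1+m≤fuel
  IH : ∀ k → k ≤ fuel → J k ≈ paths ω k 0
  IH = jcoefFuel≈paths b λ′ ω fuel h b≈ λ≈
  IH⁺ : ∀ k → k ≤ fuel → J⁺ k ≈ paths ω⁺ k 0
  IH⁺ = jcoefFuel≈paths b λ′ ω⁺ fuel (suc h)
          (λ x → trans (reflexive (≡.cong b (ℕₚ.+-suc x h))) (b≈ (suc x)))
          (λ x → trans (reflexive (≡.cong (λ′ ∘ suc) (ℕₚ.+-suc x h))) (λ≈ (suc x)))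
  regroup : (down ω 0 * up ω 1) * ∑[ i < suc m ] (paths ω⁺ i 0 * paths ω (m ∸ i) 0)
          ≈ up ω 1 * ∑[ i < suc m ] (paths ω⁺ i 0 * (down ω 0 * paths ω (m ∸ i) 0))
  regroup = trans (xy∙z≈y∙xz d (up ω 1) (∑< (suc m) a)) (*-cong (refl {up ω 1})
              (trans (∑ᵗ.*-distribˡ-∑ (suc m) d a)
                     (∑ᵗ.∑-cong (suc m) λ i → x∙yz≈y∙xz d (paths ω⁺ i 0) (paths ω (m ∸ i) 0))))
    where
    open import Algebra.Properties.CommutativeSemigroup *-commutativeSemigroup using (x∙yz≈y∙xz; xy∙z≈y∙xz)
    d = down ω 0
    a : ℕ → Carrier
    a i = paths ω⁺ i 0 * paths ω (m ∸ i) 0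

-- Operators of the form t s + (1 + t² r) D

1+t² : Q.Carrier → Carrier
1+t² r = 1# + t * (t * C r)

A[_,_] : Q.Carrier → Q.Carrier → Carrier → Carrier
A[ s , r ] f = t * (C s * f) + 1+t² r * D f

A[,]-cong : ∀ {s s′ r r′ f g} → s ≈q s′ → r ≈q r′ → f ≈ g → A[ s , r ] f ≈ A[ s′ , r′ ] g
A[,]-cong s≈s′ r≈r′ f≈g =
  +-cong (*-cong (refl {t}) (*-cong (C-cong s≈s′) f≈g))
         (*-cong (+-cong (refl {1#}) (*-cong (refl {t}) (*-cong (refl {t}) (C-cong r≈r′)))) (D-cong f≈g))

D-t*C : ∀ s f → D (t * (C s * f)) ≈ C s * f + t * (C (q *q s) * D f)
D-t*C s f = begin
  D (t * (C s * f))                  ≈⟨ D-t* (C s * f) ⟩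
  C s * f + t * (C q * D (C s * f))  ≈⟨ +-cong (refl {C s * f}) (*-cong (refl {t}) (*-cong (refl {C q}) (D-C* s f))) ⟩
  C s * f + t * (C q * (C s * D f))  ≈⟨ +-cong (refl {C s * f}) (*-cong (refl {t})
                                          (trans (sym (*-assoc (C q) (C s) (D f))) (*-cong (sym (C-* q s)) (refl {D f})))) ⟩
  C s * f + t * (C (q *q s) * D f)   ∎
  where open SetoidReasoning setoid

D-1+t²* : ∀ r g → D (1+t² r * g) ≈ t * (C ((1q +q q) *q r) * g) + 1+t² (q *q (q *q r)) * D g
D-1+t²* r g = begin
  D (1+t² r * g)
    ≈⟨ D-cong (solve 3 (λ T R G → (con 1 :+ T :* (T :* R)) :* G := G :+ T :* (T :* (R :* G))) refl t (C r) g) ⟩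
  D (g + t * (t * (C r * g)))
    ≈⟨ trans (D-+ g (t * (t * (C r * g)))) (+-cong (refl {D g}) (D-t* (t * (C r * g)))) ⟩
  D g + (t * (C r * g) + t * (C q * D (t * (C r * g))))
    ≈⟨ +-cong (refl {D g}) (+-cong (refl {t * (C r * g)}) (*-cong (refl {t}) (*-cong (refl {C q}) (D-t*C r g)))) ⟩
  D g + (t * (C r * g) + t * (C q * (C r * g + t * (C (q *q r) * D g))))
    ≈⟨ solve 6 (λ T Q R QR G DG → DG :+ (T :* (R :* G) :+ T :* (Q :* (R :* G :+ T :* (QR :* DG))))
                                := T :* (((con 1 :+ Q) :* R) :* G) :+ (con 1 :+ T :* (T :* (Q :* QR))) :* DG)
               refl t (C q) (C r) (C (q *q r)) g (D g) ⟩
  t * (((1# + C q) * C r) * g) + (1# + t * (t * (C q * C (q *q r)))) * D g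
    ≈⟨ +-cong (*-cong (refl {t}) (*-cong (sym (trans (C-* (1q +q q) r) (*-cong (C-+ 1q q) (refl {C r})))) (refl {g})))
              (*-cong (+-cong (refl {1#}) (*-cong (refl {t}) (*-cong (refl {t}) (sym (C-* q (q *q r)))))) (refl {D g})) ⟩
  t * (C ((1q +q q) *q r) * g) + 1+t² (q *q (q *q r)) * D g ∎
  where
  open SetoidReasoning setoid
  open TSolver

D-A[,] : ∀ s r f → D (A[ s , r ] f) ≈ C s * f + A[ q *q s +q (1q +q q) *q r , q *q (q *q r) ] (D f)
D-A[,] s r f = begin
  D (A[ s , r ] f)
    ≈⟨ trans (D-+ (t * (C s * f)) (1+t² r * D f)) (+-cong (D-t*C s f) (D-1+t²* r (D f))) ⟩
  (C s * f + t * (C (q *q s) * D f)) + (t * (C ((1q +q q) *q r) * D f) + 1+t² (q *q (q *q r)) * D (D f))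
    ≈⟨ solve 6 (λ X T S R Y Z → (X :+ T :* (S :* Y)) :+ (T :* (R :* Y) :+ Z) := X :+ (T :* ((S :+ R) :* Y) :+ Z))
               refl (C s * f) t (C (q *q s)) (C ((1q +q q) *q r)) (D f) (1+t² (q *q (q *q r)) * D (D f)) ⟩
  C s * f + (t * ((C (q *q s) + C ((1q +q q) *q r)) * D f) + 1+t² (q *q (q *q r)) * D (D f))
    ≈⟨ +-cong (refl {C s * f}) (+-cong (*-cong (refl {t}) (*-cong (sym (C-+ (q *q s) ((1q +q q) *q r))) (refl {D f})))
                                       (refl {1+t² (q *q (q *q r)) * D (D f)})) ⟩
  C s * f + A[ q *q s +q (1q +q q) *q r , q *q (q *q r) ] (D f) ∎
  where
  open SetoidReasoning setoid
  open TSolver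

iter-cong : ∀ {F G : Carrier → Carrier} → (∀ {f g} → f ≈ g → F f ≈ G g) →
            ∀ n {f g} → f ≈ g → iter n F f ≈ iter n G g
iter-cong F≈G zero    f≈g = f≈g
iter-cong F≈G (suc n) f≈g = F≈G (iter-cong F≈G n f≈g)

iter-D-1# : ∀ k → iter (suc k) D 1# ≈ 0#
iter-D-1# zero    = ℕ⟦q⟧⟦t⟧ˢ.coeffwise λ i → Q.zeroʳ [ suc i ]q
iter-D-1# (suc k) = trans (D-cong (iter-D-1# k)) (ℕ⟦q⟧⟦t⟧ˢ.coeffwise λ i → Q.zeroʳ [ suc i ]q)

module OperatorJFraction
  (s r w : ℕ → Q.Carrier)
  (s₀≈w₀ : s 0 ≈q w 0)
  (w-suc : ∀ k → w k +q s (suc k) ≈q w (suc k))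
  (s-suc : ∀ h → q *q s h +q (1q +q q) *q r (suc h) ≈q s (suc h))
  (r-suc : ∀ h → q *q (q *q r (suc h)) ≈q r (suc (suc h)))
  where

  A : Carrier → Carrier
  A = A[ s 0 , r 1 ]

  D^[1+k]-A : ∀ k f →
              iter (suc k) D (A f) ≈ C (w k) * iter k D f + A[ s (suc k) , r (suc (suc k)) ] (iter (suc k) D f)
  D^[1+k]-A zero f = trans (D-A[,] (s 0) (r 1) f)
    (+-cong (*-cong (C-cong s₀≈w₀) (refl {f})) (A[,]-cong (s-suc 0) (r-suc 0) (refl {D f})))
  D^[1+k]-A (suc k) f = begin
    D (iter (suc k) D (A f))
      ≈⟨ D-cong (D^[1+k]-A k f) ⟩
    D (C (w k) * Dᵏf + A[ s′ , r′ ] (D Dᵏf))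
      ≈⟨ trans (D-+ (C (w k) * Dᵏf) (A[ s′ , r′ ] (D Dᵏf)))
               (+-cong (D-C* (w k) Dᵏf) (D-A[,] s′ r′ (D Dᵏf))) ⟩
    C (w k) * D Dᵏf + (C s′ * D Dᵏf + A[ s″ , r″ ] (D (D Dᵏf)))
      ≈⟨ trans (sym (+-assoc (C (w k) * D Dᵏf) (C s′ * D Dᵏf) (A[ s″ , r″ ] (D (D Dᵏf)))))
               (+-cong (sym (distribʳ (D Dᵏf) (C (w k)) (C s′))) (refl {A[ s″ , r″ ] (D (D Dᵏf))})) ⟩
    (C (w k) + C s′) * D Dᵏf + A[ s″ , r″ ] (D (D Dᵏf))
      ≈⟨ +-cong (*-cong (trans (sym (C-+ (w k) s′)) (C-cong (w-suc k))) (refl {D Dᵏf}))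
                (A[,]-cong (s-suc (suc k)) (r-suc (suc k)) (refl {D (D Dᵏf)})) ⟩
    C (w (suc k)) * D Dᵏf + A[ s (suc (suc k)) , r (suc (suc (suc k))) ] (D (D Dᵏf)) ∎
    where
    open SetoidReasoning setoid
    Dᵏf = iter k D f
    s′ = s (suc k)
    r′ = r (suc (suc k))
    s″ = q *q s′ +q (1q +q q) *q r′
    r″ = q *q (q *q r′)

  weights : Weights
  weights = record { level = λ h → t * C (s h) ; down = λ h → C (w h) ; up = λ h → 1+t² (r h) }

  paths≈D^k-A^n : ∀ n k → paths weights n k ≈ iter k D (iter n A 1#)
  paths≈D^k-A^n zero    zero    = refl
  paths≈D^k-A^n zero    (suc k) = sym (iter-D-1# k)
  paths≈D^k-A^n (suc n) zero    =
    +-cong (level-step 0) (*-cong (refl {1+t² (r 1)}) (paths≈D^k-A^n n 1))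
    where
    level-step = λ k → trans (*-cong (refl {t * C (s k)}) (paths≈D^k-A^n n k)) (*-assoc t (C (s k)) (iter k D (iter n A 1#)))
  paths≈D^k-A^n (suc n) (suc k) = trans
    (+-cong (*-cong (refl {C (w k)}) (paths≈D^k-A^n n k))
            (+-cong (level-step (suc k)) (*-cong (refl {1+t² (r (suc (suc k)))}) (paths≈D^k-A^n n (suc (suc k))))))
    (sym (D^[1+k]-A k (iter n A 1#)))
    where
    level-step = λ k → trans (*-cong (refl {t * C (s k)}) (paths≈D^k-A^n n k)) (*-assoc t (C (s k)) (iter k D (iter n A 1#)))

  Jcoef≈A^n : ∀ (b λ′ : ℕ → Carrier) →
              (∀ h → b h ≈ t * C (s h)) → (∀ h → λ′ (suc h) ≈ C (w h) * 1+t² (r (suc h))) →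
              ∀ n → Jcoef b λ′ n ≈ iter n A 1#
  Jcoef≈A^n b λ′ b≈ λ≈ n =
    trans (jcoefFuel≈paths b λ′ weights n 0 b≈′ λ≈′ n ℕₚ.≤-refl) (paths≈D^k-A^n n 0)
    where
    b≈′  = λ x → trans (reflexive (≡.cong b (ℕₚ.+-identityʳ x))) (b≈ x)
    λ≈′ = λ x → trans (reflexive (≡.cong (λ′ ∘ suc) (ℕₚ.+-identityʳ x))) (λ≈ x)


-- The two continued fractions

module QFraction where

  sQ rQ wQ : ℕ → Q.Carrier
  sQ h = q^ h *q ([ h ]q +q [ suc h ]q)
  rQ h = q^ (2 ℕ.* h ∸ 1)
  wQ k = [ suc k ]q *q [ suc k ]q

  -- 2 * suc h ∸ 1 computes to h + suc (h + 0).
  rQ-suc : ∀ h → rQ (suc h) ≈q q *q (q^ h *q q^ h)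
  rQ-suc h = Q.trans (Q.reflexive (≡.cong q^_ (ℕₚ.+-suc h (h ℕ.+ 0))))
                     (Q.trans (q^-suc (2 ℕ.* h)) (Q.*-cong (Q.refl {q}) (q^-double h)))

  sQ₀≈1 : sQ 0 ≈q 1q
  sQ₀≈1 = Q.trans (Q.*-cong q^-zero (Q.+-cong [0]q [1]q)) (Q.trans (Q.*-identityˡ _) (Q.+-identityˡ 1q))

  sQ₀≈wQ₀ : sQ 0 ≈q wQ 0
  sQ₀≈wQ₀ = Q.trans sQ₀≈1 (Q.sym (Q.trans (Q.*-cong [1]q [1]q) (Q.*-identityˡ 1q)))

  wQ-suc : ∀ k → wQ k +q sQ (suc k) ≈q wQ (suc k)
  wQ-suc k = begin
    a *q a +q m *q (a +q [ suc (suc k) ]q)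
      ≈⟨ Q.+-cong (Q.refl {a *q a}) (Q.*-cong (Q.refl {m}) (Q.+-cong (Q.refl {a}) ([suc]q (suc k)))) ⟩
    a *q a +q m *q (a +q (a +q m))
      ≈⟨ solve 2 (λ a m → a :* a :+ m :* (a :+ (a :+ m)) := (a :+ m) :* (a :+ m)) Q.refl a m ⟩
    (a +q m) *q (a +q m)
      ≈⟨ Q.sym (Q.*-cong ([suc]q (suc k)) ([suc]q (suc k))) ⟩
    wQ (suc k) ∎
    where
    open SetoidReasoning Q.setoid
    open QSolver
    a = [ suc k ]q
    m = q^ suc k

  sQ-suc : ∀ h → q *q sQ h +q (1q +q q) *q rQ (suc h) ≈q sQ (suc h)
  sQ-suc h = begin
    q *q (m *q (a +q [ suc h ]q)) +q (1q +q q) *q rQ (suc h)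
      ≈⟨ Q.+-cong (Q.*-cong (Q.refl {q}) (Q.*-cong (Q.refl {m}) (Q.+-cong (Q.refl {a}) ([suc]q h))))
                  (Q.*-cong (Q.refl {1q +q q}) (rQ-suc h)) ⟩
    q *q (m *q (a +q (a +q m))) +q (1q +q q) *q (q *q (m *q m))
      ≈⟨ solve 3 (λ q a m → q :* (m :* (a :+ (a :+ m))) :+ (con 1 :+ q) :* (q :* (m :* m))
                            := (q :* m) :* ((a :+ m) :+ ((a :+ m) :+ q :* m))) Q.refl q a m ⟩
    (q *q m) *q ((a +q m) +q ((a +q m) +q q *q m))
      ≈⟨ Q.sym (Q.*-cong (q^-suc h) (Q.+-cong ([suc]q h)
                 (Q.trans ([suc]q (suc h)) (Q.+-cong ([suc]q h) (q^-suc h))))) ⟩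
    sQ (suc h) ∎
    where
    open SetoidReasoning Q.setoid
    open QSolver
    a = [ h ]q
    m = q^ h

  rQ-suc-suc : ∀ h → q *q (q *q rQ (suc h)) ≈q rQ (suc (suc h))
  rQ-suc-suc h = begin
    q *q (q *q rQ (suc h))
      ≈⟨ Q.*-cong (Q.refl {q}) (Q.*-cong (Q.refl {q}) (rQ-suc h)) ⟩
    q *q (q *q (q *q (m *q m)))
      ≈⟨ solve 2 (λ q m → q :* (q :* (q :* (m :* m))) := q :* ((q :* m) :* (q :* m))) Q.refl q m ⟩
    q *q ((q *q m) *q (q *q m))
      ≈⟨ Q.sym (Q.trans (rQ-suc (suc h)) (Q.*-cong (Q.refl {q}) (Q.*-cong (q^-suc h) (q^-suc h)))) ⟩
    rQ (suc (suc h)) ∎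
    where
    open SetoidReasoning Q.setoid
    open QSolver
    m = q^ h

  open OperatorJFraction sQ rQ wQ sQ₀≈wQ₀ wQ-suc sQ-suc rQ-suc-suc

  bQ≈ : ∀ h → bQ h ≈ t * C (sQ h)
  bQ≈ h = begin
    tP ⊗ qpow h ⊗ (qint h ⊕ qint (suc h))
      ≈⟨ ⊗-cong (⊗-cong (refl {t}) (qpow≈C h)) (+-cong (qint≈C h) (qint≈C (suc h))) ⟩
    (t * C (q^ h)) * (C [ h ]q + C [ suc h ]q)
      ≈⟨ trans (*-assoc t (C (q^ h)) (C [ h ]q + C [ suc h ]q))
               (*-cong (refl {t}) (*-cong (refl {C (q^ h)}) (sym (C-+ [ h ]q [ suc h ]q)))) ⟩
    t * (C (q^ h) * C ([ h ]q +q [ suc h ]q))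
      ≈⟨ *-cong (refl {t}) (sym (C-* (q^ h) ([ h ]q +q [ suc h ]q))) ⟩
    t * C (sQ h) ∎
    where open SetoidReasoning setoid

  λQ≈ : ∀ h → λQ (suc h) ≈ C (wQ h) * 1+t² (rQ (suc h))
  λQ≈ h = begin
    λQ (suc h)
      ≈⟨ ⊗-cong (⊗-cong (+-cong 1P≈1 (⊗-cong (⊗-cong (refl {t}) (refl {t})) (qpow≈C (2 ℕ.* suc h ∸ 1)))) (qint≈C (suc h)))
                (qint≈C (suc h)) ⟩
    ((1# + t * t * C r) * C a) * C a
      ≈⟨ solve 3 (λ T R A → ((con 1 :+ T :* T :* R) :* A) :* A := (A :* A) :* (con 1 :+ T :* (T :* R)))
                 refl t (C r) (C a) ⟩
    (C a * C a) * 1+t² r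
      ≈⟨ *-cong (sym (C-* a a)) (refl {1+t² r}) ⟩
    C (wQ h) * 1+t² r ∎
    where
    open SetoidReasoning setoid
    open TSolver
    a = [ suc h ]q
    r = rQ (suc h)

  Qpoly≈A^n : ∀ n → Qpoly n ≈ iter n A 1#
  Qpoly≈A^n n = iter-cong step≈A n 1P≈1
    where
    step≈A : ∀ {f g} → f ≈ g → Dop f ⊕ Uop (Dop (Uop f)) ≈ A g
    step≈A {f} {g} f≈g = begin
      Dop f ⊕ Uop (Dop (Uop f))
        ≈⟨ +-cong (Dop-cong f≈g) (Uop-cong (Dop-cong (Uop-cong f≈g))) ⟩
      D g + t * D (t * g)
        ≈⟨ +-cong (refl {D g}) (*-cong (refl {t}) (D-t* g)) ⟩
      D g + t * (g + t * (C q * D g))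
        ≈⟨ solve 4 (λ T Q G DG → DG :+ T :* (G :+ T :* (Q :* DG)) := T :* (con 1 :* G) :+ (con 1 :+ T :* (T :* Q)) :* DG)
                   refl t (C q) g (D g) ⟩
      t * (1# * g) + 1+t² q * D g
        ≈⟨ +-cong (*-cong (refl {t}) (*-cong (C-cong (Q.sym sQ₀≈1)) (refl {g}))) (refl {1+t² q * D g}) ⟩
      A g ∎
      where
      open SetoidReasoning setoid
      open TSolver

  Qpoly≈Jcoef : ∀ n → Qpoly n ≈ Jcoef bQ λQ n
  Qpoly≈Jcoef n = trans (Qpoly≈A^n n) (sym (Jcoef≈A^n bQ λQ bQ≈ λQ≈ n))

module RFraction where

  sR rR wR : ℕ → Q.Carrier
  sR h = q^ h *q ((1q +q q) *q [ suc h ]q)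
  rR h = q^ (2 ℕ.* h)
  wR k = [ suc k ]q *q [ suc (suc k) ]q

  rR-suc : ∀ h → rR (suc h) ≈q q *q (q *q (q^ h *q q^ h))
  rR-suc h = Q.trans (Q.reflexive (≡.cong q^_ (ℕₚ.*-suc 2 h)))
                     (Q.trans (q^-2+ (2 ℕ.* h)) (Q.*-cong (Q.refl {q}) (Q.*-cong (Q.refl {q}) (q^-double h))))

  [2]q : [ 2 ]q ≈q 1q +q q
  [2]q = Q.trans ([suc]q 1) (Q.+-cong [1]q (Q.refl {q}))

  sR₀≈1+q : sR 0 ≈q 1q +q q
  sR₀≈1+q = Q.trans (Q.*-cong q^-zero (Q.*-cong (Q.refl {1q +q q}) [1]q))
                    (Q.trans (Q.*-identityˡ _) (Q.*-identityʳ (1q +q q)))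

  sR₀≈wR₀ : sR 0 ≈q wR 0
  sR₀≈wR₀ = Q.trans sR₀≈1+q (Q.sym (Q.trans (Q.*-cong [1]q [2]q) (Q.*-identityˡ (1q +q q))))

  wR-suc : ∀ k → wR k +q sR (suc k) ≈q wR (suc k)
  wR-suc k = begin
    a *q [ suc (suc k) ]q +q m *q ((1q +q q) *q [ suc (suc k) ]q)
      ≈⟨ Q.+-cong (Q.*-cong (Q.refl {a}) ([suc]q (suc k)))
                  (Q.*-cong (Q.refl {m}) (Q.*-cong (Q.refl {1q +q q}) ([suc]q (suc k)))) ⟩
    a *q (a +q m) +q m *q ((1q +q q) *q (a +q m))
      ≈⟨ solve 3 (λ q a m → a :* (a :+ m) :+ m :* ((con 1 :+ q) :* (a :+ m)) := (a :+ m) :* ((a :+ m) :+ q :* m))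
                 Q.refl q a m ⟩
    (a +q m) *q ((a +q m) +q q *q m)
      ≈⟨ Q.sym (Q.*-cong ([suc]q (suc k))
                         (Q.trans ([suc]q (suc (suc k))) (Q.+-cong ([suc]q (suc k)) (q^-suc (suc k))))) ⟩
    wR (suc k) ∎
    where
    open SetoidReasoning Q.setoid
    open QSolver
    a = [ suc k ]q
    m = q^ suc k

  sR-suc : ∀ h → q *q sR h +q (1q +q q) *q rR (suc h) ≈q sR (suc h)
  sR-suc h = begin
    q *q sR h +q (1q +q q) *q rR (suc h)
      ≈⟨ Q.+-cong (Q.refl {q *q sR h}) (Q.*-cong (Q.refl {1q +q q}) (rR-suc h)) ⟩
    q *q (m *q ((1q +q q) *q a)) +q (1q +q q) *q (q *q (q *q (m *q m)))
      ≈⟨ solve 3 (λ q a m → q :* (m :* ((con 1 :+ q) :* a)) :+ (con 1 :+ q) :* (q :* (q :* (m :* m)))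
                            := (q :* m) :* ((con 1 :+ q) :* (a :+ q :* m))) Q.refl q a m ⟩
    (q *q m) *q ((1q +q q) *q (a +q q *q m))
      ≈⟨ Q.sym (Q.*-cong (q^-suc h)
                         (Q.*-cong (Q.refl {1q +q q}) (Q.trans ([suc]q (suc h)) (Q.+-cong (Q.refl {a}) (q^-suc h))))) ⟩
    sR (suc h) ∎
    where
    open SetoidReasoning Q.setoid
    open QSolver
    a = [ suc h ]q
    m = q^ h

  rR-suc-suc : ∀ h → q *q (q *q rR (suc h)) ≈q rR (suc (suc h))
  rR-suc-suc h = begin
    q *q (q *q rR (suc h))
      ≈⟨ Q.*-cong (Q.refl {q}) (Q.*-cong (Q.refl {q}) (rR-suc h)) ⟩
    q *q (q *q (q *q (q *q (m *q m))))
      ≈⟨ solve 2 (λ q m → q :* (q :* (q :* (q :* (m :* m)))) := q :* (q :* ((q :* m) :* (q :* m)))) Q.refl q m ⟩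
    q *q (q *q ((q *q m) *q (q *q m)))
      ≈⟨ Q.sym (Q.trans (rR-suc (suc h)) (Q.*-cong (Q.refl {q}) (Q.*-cong (Q.refl {q}) (Q.*-cong (q^-suc h) (q^-suc h))))) ⟩
    rR (suc (suc h)) ∎
    where
    open SetoidReasoning Q.setoid
    open QSolver
    m = q^ h

  open OperatorJFraction sR rR wR sR₀≈wR₀ wR-suc sR-suc rR-suc-suc

  bR≈ : ∀ h → bR h ≈ t * C (sR h)
  bR≈ h = begin
    tP ⊗ qpow h ⊗ (1P ⊕ qpow 1) ⊗ qint (suc h)
      ≈⟨ ⊗-cong (⊗-cong (⊗-cong (refl {t}) (qpow≈C h)) (+-cong 1P≈1 (qpow≈C 1))) (qint≈C (suc h)) ⟩
    ((t * C m) * (1# + C q)) * C a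
      ≈⟨ solve 4 (λ T M Q A → ((T :* M) :* (con 1 :+ Q)) :* A := T :* (M :* ((con 1 :+ Q) :* A)))
                 refl t (C m) (C q) (C a) ⟩
    t * (C m * ((1# + C q) * C a))
      ≈⟨ *-cong (refl {t}) (sym (trans (C-* m ((1q +q q) *q a))
                                       (*-cong (refl {C m}) (trans (C-* (1q +q q) a) (*-cong (C-+ 1q q) (refl {C a})))))) ⟩
    t * C (sR h) ∎
    where
    open SetoidReasoning setoid
    open TSolver
    a = [ suc h ]q
    m = q^ h

  λR≈ : ∀ h → λR (suc h) ≈ C (wR h) * 1+t² (rR (suc h))
  λR≈ h = begin
    λR (suc h)
      ≈⟨ ⊗-cong (⊗-cong (+-cong 1P≈1 (⊗-cong (⊗-cong (refl {t}) (refl {t})) (qpow≈C (2 ℕ.* suc h)))) (qint≈C (suc h)))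
                (qint≈C (suc (suc h))) ⟩
    ((1# + t * t * C r) * C a) * C b
      ≈⟨ solve 4 (λ T R A B → ((con 1 :+ T :* T :* R) :* A) :* B := (A :* B) :* (con 1 :+ T :* (T :* R)))
                 refl t (C r) (C a) (C b) ⟩
    (C a * C b) * 1+t² r
      ≈⟨ *-cong (sym (C-* a b)) (refl {1+t² r}) ⟩
    C (wR h) * 1+t² r ∎
    where
    open SetoidReasoning setoid
    open TSolver
    a = [ suc h ]q
    b = [ suc (suc h) ]q
    r = rR (suc h)

  Rpoly≈A^n : ∀ n → Rpoly n ≈ iter n A 1#
  Rpoly≈A^n n = iter-cong step≈A n 1P≈1
    where
    step≈A : ∀ {f g} → f ≈ g → Dop f ⊕ Dop (Uop (Uop f)) ≈ A g
    step≈A {f} {g} f≈g = begin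
      Dop f ⊕ Dop (Uop (Uop f))
        ≈⟨ +-cong (Dop-cong f≈g) (Dop-cong (Uop-cong (Uop-cong f≈g))) ⟩
      D g + D (t * (t * g))
        ≈⟨ +-cong (refl {D g})
                  (trans (D-t* (t * g)) (+-cong (refl {t * g}) (*-cong (refl {t}) (*-cong (refl {C q}) (D-t* g))))) ⟩
      D g + (t * g + t * (C q * (g + t * (C q * D g))))
        ≈⟨ solve 4 (λ T Q G DG → DG :+ (T :* G :+ T :* (Q :* (G :+ T :* (Q :* DG))))
                                := T :* ((con 1 :+ Q) :* G) :+ (con 1 :+ T :* (T :* (Q :* Q))) :* DG)
                   refl t (C q) g (D g) ⟩
      t * ((1# + C q) * g) + (1# + t * (t * (C q * C q))) * D g
        ≈⟨ +-cong (*-cong (refl {t}) (*-cong (sym (trans (C-cong sR₀≈1+q) (C-+ 1q q))) (refl {g})))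
                  (*-cong (+-cong (refl {1#}) (*-cong (refl {t}) (*-cong (refl {t}) (sym (trans (C-cong (q^-suc 1)) (C-* q q))))))
                          (refl {D g})) ⟩
      A g ∎
      where
      open SetoidReasoning setoid
      open TSolver

  Rpoly≈Jcoef : ∀ n → Rpoly n ≈ Jcoef bR λR n
  Rpoly≈Jcoef n = trans (Rpoly≈A^n n) (sym (Jcoef≈A^n bR λR bR≈ λR≈ n))

proposition2p5 : (∀ (n : ℕ) → Qpoly n ≈P Jcoef bQ λQ n) × (∀ (n : ℕ) → Rpoly n ≈P Jcoef bR λR n)
proposition2p5 = (λ n → ≈⇒≈P (QFraction.Qpoly≈Jcoef n)) , (λ n → ≈⇒≈P (RFraction.Rpoly≈Jcoef n))
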